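{- Let $X$ be a finite set with $|X|\ge 2$, let $N=(V,E)$ be an undirected binary phylogenetic network on $X$, let $e_\rho\in E$, and let $\delta^-:V\to\mathbb{Z}_{\ge 0}$ be a desired in-degree function. Let $V_R:=\{v\in V\mid \delta^-(v)=2\}$. If there exists an orientation $\vec N$ of $N$ satisfying the constraint $(e_\rho,\delta^-)$, then for every cycle basis $\mathcal{S}$ of $N$ there exists a bijection $\phi:\mathcal{S}\to V_R$ such that $\phi(C)\in V(C)$ for every $C\in\mathcal{S}$.
   Context: All graphs are finite and simple. An undirected binary phylogenetic network on $X$ is a simple connected undirected graph whose vertices all have degree $3$ (internal vertices) or degree $1$ (leaves), with the set of leaves identified with $X$. A directed binary phylogenetic network on $X$ is a simple acyclic directed graph with connected underlying graph, having a unique vertex $\rho$ (the root) with (in-degree, out-degree) $=(0,2)$, all other vertices having (in, out)-degree $(1,2)$ (tree vertices), $(2,1)$ (reticulations) or $(1,0)$ (leaves), with the leaves identified with $X$. An orientation of $N$ with root edge $e_\rho=\{u,v\}$ is obtained by inserting a new vertex $\rho$ into $e_\rho$ (replacing $\{u,v\}$ by arcs $(\rho,u),(\rho,v)$) and orienting every other edge so that the result is a directed binary phylogenetic network on $X$ (leaf labels preserved). It satisfies the constraint $(e_\rho,\delta^-)$ if its root is inserted into $e_\rho$ and every $v\in V$ has in-degree $\delta^-(v)$ in it. The cycle space of $N$ is the vector space over $\mathbb{F}_2$ of edge subsets of $N$ inducing subgraphs with all degrees even (addition = symmetric difference); a cycle basis of $N$ is a set of cycles of $N$ whose edge sets form a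 basis of the cycle space (it has $|E|-|V|+1$ elements). -}

module Defs where

open import Data.Nat using (ℕ; zero; suc; _+_; _≤_; _∸_)
open import Data.Nat.Divisibility using (_∣_)
open import Data.Fin using (Fin; zero; suc; fromℕ; inject₁; _≟_)
open import Data.Bool using (Bool; true; false; _∧_; _xor_; if_then_else_)
open import Data.Maybe using (Maybe; just; nothing)
open import Data.Product using (Σ; ∃; _×_; _,_; proj₁)
open import Data.Sum using (_⊎_)
open import Data.Fin.Properties using (any?)
open import Relation.Nullary using (¬_; Dec; yes; no)
open import Relation.Nullary.Decidable using (⌊_⌋; _×-dec_; _⊎-dec_)
open import Relation.Binary.PropositionalEquality using (_≡_; _≢_)
open import Function.Bundles using (_⤖_; Bijection)

sumFin : (n : ℕ) → (Fin n → ℕ) → ℕ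
sumFin zero    f = 0
sumFin (suc n) f = f zero + sumFin n (λ i → f (suc i))

xorFin : (n : ℕ) → (Fin n → Bool) → Bool
xorFin zero    f = false
xorFin (suc n) f = f zero xor xorFin n (λ i → f (suc i))

ind : Bool → ℕ
ind b = if b then 1 else 0

-- Finite multigraphs given by an edge list: vertices Fin n, edges Fin m,
-- edge e has endpoints src e and tgt e (the order is irrelevant).

record Graph : Set where
  field
    n   : ℕ
    m   : ℕ
    src : Fin m → Fin n
    tgt : Fin m → Fin n

module _ (G : Graph) where
  open Graph G

  Joins : Fin m → Fin n → Fin n → Set
  Joins e u v = (src e ≡ u × tgt e ≡ v) ⊎ (src e ≡ v × tgt e ≡ u)

  joins? : (e : Fin m) (u v : Fin n) → Dec (Joins e u v)
  joins? e u v = ((src e ≟ u) ×-dec (tgt e ≟ v)) ⊎-dec ((src e ≟ v) ×-dec (tgt e ≟ u))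

  Adj : Fin n → Fin n → Set
  Adj u v = ∃ λ e → Joins e u v

  incident : Fin m → Fin n → Bool
  incident e v = ⌊ (src e ≟ v) ⊎-dec (tgt e ≟ v) ⌋

  degree : Fin n → ℕ
  degree v = sumFin m (λ e → ind (incident e v))

  Simple : Set
  Simple = (∀ e → src e ≢ tgt e) × (∀ e f → Joins f (src e) (tgt e) → e ≡ f)

  Connected : Set
  Connected = ∀ u v → ∃ λ l → Σ (Fin (suc l) → Fin n) λ w →
    (w zero ≡ u) × (w (fromℕ l) ≡ v) × (∀ (i : Fin l) → Adj (w (inject₁ i)) (w (suc i)))

  IsLeaf : Fin n → Set
  IsLeaf v = degree v ≡ 1

  -- undirected binary phylogenetic network on X = Fin k, with leaf labelling lab
  IsUndirBinPhyloNet : (k : ℕ) → (Fin k → Fin n) → Set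
  IsUndirBinPhyloNet k lab =
    Simple × Connected ×
    (∀ v → degree v ≡ 1 ⊎ degree v ≡ 3) ×
    (∀ x y → lab x ≡ lab y → x ≡ y) ×
    (∀ x → IsLeaf (lab x)) ×
    (∀ v → IsLeaf v → ∃ λ x → lab x ≡ v)

  -- The root ρ is represented by 'nothing', vertex v of N
  -- by 'just v'.  An orientation with root edge eρ is given by a direction
  -- for every edge (true: src → tgt, false: tgt → src); the direction of
  -- eρ is ignored, as eρ is replaced by the arcs (ρ, src eρ), (ρ, tgt eρ).

  head : (Fin m → Bool) → Fin m → Fin n
  head dir e = if dir e then tgt e else src e

  tail : (Fin m → Bool) → Fin m → Fin n
  tail dir e = if dir e then src e else tgt e

  data Arc (eρ : Fin m) (dir : Fin m → Bool) : Maybe (Fin n) → Maybe (Fin n) → Set where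
    rootArc₁ : Arc eρ dir nothing (just (src eρ))
    rootArc₂ : Arc eρ dir nothing (just (tgt eρ))
    edgeArc  : ∀ e → e ≢ eρ → Arc eρ dir (just (tail dir e)) (just (head dir e))

  notRoot : Fin m → Fin m → Bool
  notRoot eρ e = ⌊ Relation.Nullary.Decidable.¬? (e ≟ eρ) ⌋

  indeg : Fin m → (Fin m → Bool) → Fin n → ℕ
  indeg eρ dir v = ind (incident eρ v) +
    sumFin m (λ e → ind (notRoot eρ e ∧ ⌊ head dir e ≟ v ⌋))

  outdeg : Fin m → (Fin m → Bool) → Fin n → ℕ
  outdeg eρ dir v =
    sumFin m (λ e → ind (notRoot eρ e ∧ ⌊ tail dir e ≟ v ⌋))

  Acyclic : Fin m → (Fin m → Bool) → Set
  Acyclic eρ dir = ∀ l → (w : Fin (suc (suc l)) → Maybe (Fin n)) →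
    w zero ≡ w (fromℕ (suc l)) →
    ¬ (∀ (i : Fin (suc l)) → Arc eρ dir (w (inject₁ i)) (w (suc i)))

  -- the result is a directed binary phylogenetic network: acyclic, and every
  -- non-root vertex is a tree vertex (1,2), a reticulation (2,1) or a leaf (1,0)
  -- (the root has (in,out) = (0,2) by construction).
  IsOrientation : Fin m → (Fin m → Bool) → Set
  IsOrientation eρ dir = Acyclic eρ dir ×
    (∀ v → (indeg eρ dir v ≡ 1 × outdeg eρ dir v ≡ 2)
         ⊎ (indeg eρ dir v ≡ 2 × outdeg eρ dir v ≡ 1)
         ⊎ (indeg eρ dir v ≡ 1 × outdeg eρ dir v ≡ 0))

  SatisfiesConstraint : Fin m → (Fin n → ℕ) → (Fin m → Bool) → Set
  SatisfiesConstraint eρ δ dir = IsOrientation eρ dir × (∀ v → indeg eρ dir v ≡ δ v)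

  -- Cycles: a cyclic sequence c 0, …, c (l+2) of distinct vertices
  -- (length l+3 ≥ 3), consecutive ones adjacent.

  record Cycle : Set where
    field
      len  : ℕ
      vtx  : Fin (suc (suc (suc len))) → Fin n
      inj  : ∀ i j → vtx i ≡ vtx j → i ≡ j
      adj  : ∀ (i : Fin (suc (suc len))) → Adj (vtx (inject₁ i)) (vtx (suc i))
      adj₀ : Adj (vtx (fromℕ (suc (suc len)))) (vtx zero)

  _∈V_ : Fin n → Cycle → Set
  v ∈V C = ∃ λ i → Cycle.vtx C i ≡ v

  edgeSet : Cycle → Fin m → Bool
  edgeSet C e = ⌊ any? (λ i → joins? e (vtx (inject₁ i)) (vtx (suc i))) ⌋
                ∨' ⌊ joins? e (vtx (fromℕ (suc (suc len)))) (vtx zero) ⌋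
    where
      open Cycle C
      _∨'_ : Bool → Bool → Bool
      true ∨' _ = true
      false ∨' b = b

  InCycleSpace : (Fin m → Bool) → Set
  InCycleSpace z = ∀ v → 2 ∣ sumFin m (λ e → ind (z e ∧ incident e v))

  combo : (k : ℕ) → (Fin k → Cycle) → (Fin k → Bool) → Fin m → Bool
  combo k S c e = xorFin k (λ i → c i ∧ edgeSet (S i) e)

  IsCycleBasis : (k : ℕ) → (Fin k → Cycle) → Set
  IsCycleBasis k S =
    (∀ c → (∀ e → combo k S c e ≡ false) → ∀ i → c i ≡ false) ×
    (∀ z → InCycleSpace z → ∃ λ c → ∀ e → combo k S c e ≡ z e)

VR : (n : ℕ) → (Fin n → ℕ) → Set
VR n δ = Σ (Fin n) λ v → δ v ≡ 2

-- Fix an orientation satisfying the constraint. Every reticulation r has an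
-- incoming arc a(r) ≠ eρ; every other vertex off eρ has exactly one incoming
-- arc that is not of this form, its tree arc. By acyclicity the tree arcs and
-- eρ form a spanning tree whose complement is {a(r)}, so an even edge set
-- avoiding every a(r) is empty, and the fundamental cycle of a(r) contains
-- a(r') iff r = r'.
--
-- Let M be the 0/1 matrix with M(C, r) = [a(r) ∈ C] for basis cycles C and
-- reticulations r. Its rows are independent over 𝔽₂ (a vanishing combination
-- of basis cycles avoids every a(r), hence is empty) and so are its columns
-- (pair a vanishing combination with the coordinates of a fundamental cycle).
-- Independent rows of a 0/1 matrix over 𝔽₂ admit distinct representatives among
-- their nonzero entries, so M and its transpose give injections both ways,
-- hence a bijection C ↦ r with a(r) ∈ C; then r, the head of a(r), lies on C.

{-# OPTIONS --safe #-}
module Submission where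

open import Defs
open import Algebra using (CommutativeRing)
open import Data.Bool using (Bool; true; false; not; _∧_; _xor_)
open import Data.Maybe using (just)
open import Data.Bool.Properties as Bool
  using (xor-∧-commutativeRing; xor-same; xor-comm; xor-identityʳ;
         ∧-distribˡ-xor; ∧-distribʳ-xor; ∧-zeroʳ; ∧-identityʳ; ∧-comm; ∧-conicalˡ; ∧-conicalʳ)
open import Data.Empty using (⊥-elim)
open import Function using (_∘_; flip)
open import Function.Definitions using (Injective; Surjective)
open import Function.Bundles using (_⤖_; Bijection; mk⤖)
open import Data.Fin using (Fin; zero; suc; fromℕ; inject₁; toℕ; punchOut; _≟_)
open import Data.Fin.Properties using (any?; all?; injective⇒≤; punchOut-injective; pigeonhole; toℕ<n;
         toℕ-inject₁; toℕ-fromℕ; inject₁-injective)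
open import Data.Fin.Subset.Properties using (anySubset?)
open import Data.Vec using (lookup; tabulate)
open import Data.Vec.Properties using (lookup∘tabulate)
open import Data.Vec.Functional using (_∷_)
open import Data.Nat using (ℕ; zero; suc; _+_; _*_; _∸_; _≤_; _<_; s≤s; s≤s⁻¹)
open import Data.Nat.Divisibility using (_∣_; divides)
import Data.Nat.Properties as ℕ
open import Data.Product using (Σ; ∃; ∃-syntax; _×_; _,_; proj₁; proj₂)
open import Data.Sum using (_⊎_; inj₁; inj₂)
open import Relation.Nullary using (¬_; yes; no; ¬?; contradiction)
open import Relation.Nullary.Decidable using (⌊_⌋; does; Dec; map′; _×-dec_; _→-dec_; dec-true; dec-false)
open import Relation.Binary.PropositionalEquality

open import Algebra.Properties.CommutativeSemigroup
  (CommutativeRing.+-commutativeSemigroup xor-∧-commutativeRing)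
  using () renaming (interchange to xor-interchange)
open import Algebra.Properties.CommutativeSemigroup
  (CommutativeRing.*-commutativeSemigroup xor-∧-commutativeRing)
  using () renaming (x∙yz≈y∙xz to ∧-leftSwap; x∙yz≈z∙xy to ∧-rotate)

module _ {A : Set} where

  _⊕_ : (A → Bool) → (A → Bool) → A → Bool
  (u ⊕ v) x = u x xor v x

  ∅ : A → Bool
  ∅ _ = false

⁅_⁆ : ∀ {k} → Fin k → Fin k → Bool
⁅ j ⁆ i = does (j ≟ i)

does⇒ : ∀ {A : Set} (a? : Dec A) → does a? ≡ true → A
does⇒ (yes a) _ = a

⁅⁆-self : ∀ {k} (j : Fin k) → ⁅ j ⁆ j ≡ true
⁅⁆-self j = dec-true (j ≟ j) refl

⁅⁆-other : ∀ {k} {j i : Fin k} → j ≢ i → ⁅ j ⁆ i ≡ false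
⁅⁆-other {j = j} {i} = dec-false (j ≟ i)

⁅⁆-comm : ∀ {k} (i j : Fin k) → ⁅ j ⁆ i ≡ ⁅ i ⁆ j
⁅⁆-comm i j with i ≟ j
... | yes refl = ⁅⁆-self i
... | no i≢j   = ⁅⁆-other (≢-sym i≢j)

⁅⁆-injective : ∀ {k l} {f : Fin k → Fin l} → Injective _≡_ _≡_ f →
  ∀ j i → ⁅ f j ⁆ (f i) ≡ ⁅ j ⁆ i
⁅⁆-injective {f = f} f-injective j i with j ≟ i
... | yes refl = ⁅⁆-self (f j)
... | no j≢i   = ⁅⁆-other (j≢i ∘ f-injective)

xor-cancelMiddle : ∀ x y z → (x xor y) xor (y xor z) ≡ x xor z
xor-cancelMiddle false false z = refl
xor-cancelMiddle false true  z = Bool.not-involutive z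
xor-cancelMiddle true  false z = refl
xor-cancelMiddle true  true  z = refl

xorFin-cong : ∀ k {f g : Fin k → Bool} → f ≗ g → xorFin k f ≡ xorFin k g
xorFin-cong zero    f≗g = refl
xorFin-cong (suc k) f≗g = cong₂ _xor_ (f≗g zero) (xorFin-cong k (f≗g ∘ suc))

xorFin-∅ : ∀ k {f : Fin k → Bool} → f ≗ ∅ → xorFin k f ≡ false
xorFin-∅ zero    f≗∅ = refl
xorFin-∅ (suc k) f≗∅ = cong₂ _xor_ (f≗∅ zero) (xorFin-∅ k (f≗∅ ∘ suc))

xorFin-⊕ : ∀ k (f g : Fin k → Bool) → xorFin k (f ⊕ g) ≡ xorFin k f xor xorFin k g
xorFin-⊕ zero    f g = refl
xorFin-⊕ (suc k) f g = begin
  (f zero xor g zero) xor xorFin k ((f ∘ suc) ⊕ (g ∘ suc))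
    ≡⟨ cong ((f zero xor g zero) xor_) (xorFin-⊕ k (f ∘ suc) (g ∘ suc)) ⟩
  (f zero xor g zero) xor (xorFin k (f ∘ suc) xor xorFin k (g ∘ suc))
    ≡⟨ xor-interchange (f zero) (g zero) _ _ ⟩
  xorFin (suc k) f xor xorFin (suc k) g ∎
  where open ≡-Reasoning

xorFin-∧ˡ : ∀ k b (f : Fin k → Bool) → xorFin k (λ i → b ∧ f i) ≡ b ∧ xorFin k f
xorFin-∧ˡ zero    b f = sym (∧-zeroʳ b)
xorFin-∧ˡ (suc k) b f = trans (cong ((b ∧ f zero) xor_) (xorFin-∧ˡ k b (f ∘ suc)))
                              (sym (∧-distribˡ-xor b (f zero) _))

xorFin-swap : ∀ k l (f : Fin k → Fin l → Bool) →
  xorFin k (λ i → xorFin l (f i)) ≡ xorFin l (λ j → xorFin k (λ i → f i j))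
xorFin-swap zero    l f = sym (xorFin-∅ l (λ _ → refl))
xorFin-swap (suc k) l f = trans (cong (xorFin l (f zero) xor_) (xorFin-swap k l (f ∘ suc)))
                                (sym (xorFin-⊕ l (f zero) _))

xorFin-∧-swap : ∀ k l (c : Fin k → Bool) (d : Fin l → Bool) (M : Fin k → Fin l → Bool) →
  xorFin l (λ j → d j ∧ xorFin k (λ i → c i ∧ M i j)) ≡
  xorFin k (λ i → c i ∧ xorFin l (λ j → d j ∧ M i j))
xorFin-∧-swap k l c d M = begin
  xorFin l (λ j → d j ∧ xorFin k (λ i → c i ∧ M i j))
    ≡⟨ xorFin-cong l (λ j → sym (xorFin-∧ˡ k (d j) _)) ⟩
  xorFin l (λ j → xorFin k (λ i → d j ∧ (c i ∧ M i j)))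
    ≡⟨ sym (xorFin-swap k l _) ⟩
  xorFin k (λ i → xorFin l (λ j → d j ∧ (c i ∧ M i j)))
    ≡⟨ xorFin-cong k (λ i → xorFin-cong l (λ j → ∧-leftSwap (d j) (c i) (M i j))) ⟩
  xorFin k (λ i → xorFin l (λ j → c i ∧ (d j ∧ M i j)))
    ≡⟨ xorFin-cong k (λ i → xorFin-∧ˡ l (c i) _) ⟩
  xorFin k (λ i → c i ∧ xorFin l (λ j → d j ∧ M i j)) ∎
  where open ≡-Reasoning

xorFin-⁅⁆ : ∀ k (j : Fin k) (f : Fin k → Bool) → xorFin k (λ i → ⁅ j ⁆ i ∧ f i) ≡ f j
xorFin-⁅⁆ (suc k) zero    f = trans (cong (f zero xor_) (xorFin-∅ k (λ _ → refl))) (xor-identityʳ (f zero))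
xorFin-⁅⁆ (suc k) (suc j) f = xorFin-⁅⁆ k j (f ∘ suc)

xorFin-telescope : ∀ k (g : Fin (suc k) → Bool) →
  xorFin k (λ i → g (inject₁ i) xor g (suc i)) ≡ g zero xor g (fromℕ k)
xorFin-telescope zero    g = sym (xor-same (g zero))
xorFin-telescope (suc k) g = begin
  (g zero xor g (suc zero)) xor xorFin k (λ i → g (suc (inject₁ i)) xor g (suc (suc i)))
    ≡⟨ cong ((g zero xor g (suc zero)) xor_) (xorFin-telescope k (g ∘ suc)) ⟩
  (g zero xor g (suc zero)) xor (g (suc zero) xor g (suc (fromℕ k)))
    ≡⟨ xor-cancelMiddle (g zero) (g (suc zero)) (g (suc (fromℕ k))) ⟩
  g zero xor g (suc (fromℕ k)) ∎
  where open ≡-Reasoning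

xorFin-⁅⁆-true : ∀ k (j : Fin k) → xorFin k ⁅ j ⁆ ≡ true
xorFin-⁅⁆-true k j = trans (xorFin-cong k (λ i → sym (∧-identityʳ (⁅ j ⁆ i))))
                           (xorFin-⁅⁆ k j (λ _ → true))

xorFin-false⇒another : ∀ k (f : Fin k → Bool) {e} → xorFin k f ≡ false → f e ≡ true →
  ∃[ e′ ] e′ ≢ e × f e′ ≡ true
xorFin-false⇒another k f {e} Σf≡false fe≡true
  with any? (λ i → ¬? (i ≟ e) ×-dec (f i Bool.≟ true))
... | yes found = found
... | no none = contradiction (trans (sym (xorFin-⁅⁆-true k e)) (trans (xorFin-cong k ⁅e⁆≗f) Σf≡false))
                              (λ ())
  where
  ⁅e⁆≗f : ⁅ e ⁆ ≗ f
  ⁅e⁆≗f i with e ≟ i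
  ... | yes refl = sym fe≡true
  ... | no e≢i with f i in fi
  ...   | false = refl
  ...   | true  = contradiction (i , ≢-sym e≢i , fi) none

count : ∀ k → (Fin k → Bool) → ℕ
count k f = sumFin k (ind ∘ f)

count-cong : ∀ k {f g : Fin k → Bool} → f ≗ g → count k f ≡ count k g
count-cong zero    f≗g = refl
count-cong (suc k) f≗g = cong₂ _+_ (cong ind (f≗g zero)) (count-cong k (f≗g ∘ suc))

count-parity : ∀ k (f : Fin k → Bool) → ∃[ q ] count k f ≡ ind (xorFin k f) + q * 2
count-parity zero    f = 0 , refl
count-parity (suc k) f with count-parity k (f ∘ suc)
... | q , eq with f zero | xorFin k (f ∘ suc)
...   | false | _     = q , eq
...   | true  | false = q , cong suc eq
...   | true  | true  = suc q , cong suc eq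

xorFin-false⇒count-even : ∀ k (f : Fin k → Bool) → xorFin k f ≡ false → 2 ∣ count k f
xorFin-false⇒count-even k f Σf≡false with count-parity k f
... | q , eq rewrite Σf≡false = divides q eq

count-remove : ∀ k (f : Fin k → Bool) {e} → f e ≡ true →
  count k f ≡ suc (count k (λ i → f i ∧ not (⁅ e ⁆ i)))
count-remove (suc k) f {zero} fe≡true rewrite fe≡true =
  cong suc (count-cong k (λ i → sym (∧-identityʳ (f (suc i)))))
count-remove (suc k) f {suc e} fe≡true = begin
  ind (f zero) + count k (f ∘ suc)
    ≡⟨ cong (ind (f zero) +_) (count-remove k (f ∘ suc) fe≡true) ⟩
  ind (f zero) + suc (count k (λ i → f (suc i) ∧ not (⁅ e ⁆ i)))
    ≡⟨ ℕ.+-suc (ind (f zero)) _ ⟩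
  suc (ind (f zero) + count k (λ i → f (suc i) ∧ not (⁅ e ⁆ i)))
    ≡⟨ cong (λ b → suc (ind b + count k (λ i → f (suc i) ∧ not (⁅ e ⁆ i))))
            (sym (∧-identityʳ (f zero))) ⟩
  suc (count (suc k) (λ i → f i ∧ not (⁅ suc e ⁆ i))) ∎
  where open ≡-Reasoning

count-nonzero : ∀ k (f : Fin k → Bool) {c} → count k f ≡ suc c → ∃[ e ] f e ≡ true
count-nonzero (suc k) f count≡suc with f zero in f0
... | true  = zero , f0
... | false = let e , fe = count-nonzero k (f ∘ suc) count≡suc in suc e , fe

count-zero : ∀ k (f : Fin k → Bool) → count k f ≡ 0 → ∀ e → f e ≡ false
count-zero k f count≡0 e with f e in fe
... | false = refl
... | true  = contradiction (trans (sym (count-remove k f fe)) count≡0) λ ()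

count-one-unique : ∀ k (f : Fin k → Bool) → count k f ≡ 1 →
  ∀ {e e′} → f e ≡ true → f e′ ≡ true → e ≡ e′
count-one-unique k f count≡1 {e} {e′} fe fe′ with e′ ≟ e
... | yes e′≡e = sym e′≡e
... | no e′≢e = contradiction
  (trans (cong₂ (λ x y → x ∧ not y) (sym fe′) (sym (⁅⁆-other (≢-sym e′≢e))))
         (count-zero k _ (ℕ.suc-injective (trans (sym (count-remove k f fe)) count≡1)) e′))
  λ ()

linComb : ∀ {k} {A : Set} → (Fin k → A → Bool) → (Fin k → Bool) → A → Bool
linComb {k} w d x = xorFin k (λ i → d i ∧ w i x)

module _ {k : ℕ} {A : Set} (w : Fin k → A → Bool) where

  linComb-cong : ∀ {d d′} → d ≗ d′ → linComb w d ≗ linComb w d′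
  linComb-cong d≗d′ x = xorFin-cong k (λ i → cong (_∧ w i x) (d≗d′ i))

  linComb-∅ : ∀ {d} → d ≗ ∅ → linComb w d ≗ ∅
  linComb-∅ d≗∅ x = xorFin-∅ k (λ i → cong (_∧ w i x) (d≗∅ i))

  linComb-⊕ : ∀ d d′ → linComb w (d ⊕ d′) ≗ linComb w d ⊕ linComb w d′
  linComb-⊕ d d′ x = trans (xorFin-cong k (λ i → ∧-distribʳ-xor (w i x) (d i) (d′ i))) (xorFin-⊕ k _ _)

linComb-linComb : ∀ {k l} {B : Set} (M : Fin k → B → Bool) (zs : Fin l → Fin k → Bool) c →
  linComb M (linComb zs c) ≗ linComb (λ i → linComb M (zs i)) c
linComb-linComb {k} {l} M zs c x = begin
  xorFin k (λ e → linComb zs c e ∧ M e x)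
    ≡⟨ xorFin-cong k (λ e → ∧-comm (linComb zs c e) (M e x)) ⟩
  xorFin k (λ e → M e x ∧ xorFin l (λ i → c i ∧ zs i e))
    ≡⟨ xorFin-∧-swap l k c (λ e → M e x) zs ⟩
  xorFin l (λ i → c i ∧ xorFin k (λ e → M e x ∧ zs i e))
    ≡⟨ xorFin-cong l (λ i → cong (c i ∧_) (xorFin-cong k (λ e → ∧-comm (M e x) (zs i e)))) ⟩
  linComb (λ i → linComb M (zs i)) c x ∎
  where open ≡-Reasoning

module _ {k R : ℕ} (w : Fin k → Fin R → Bool) (Q : Fin k → Bool) where

  Supported : (Fin k → Bool) → Set
  Supported d = ∀ i → d i ≡ true → Q i ≡ true

  LinearlyIndependent : Set
  LinearlyIndependent = ∀ d → Supported d → linComb w d ≗ ∅ → d ≗ ∅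

  InSpan : (Fin R → Bool) → Set
  InSpan u = ∃[ d ] Supported d × linComb w d ≗ u

  record Transversal : Set where
    field
      σ           : (i : Fin k) → Q i ≡ true → Fin R
      σ-hits      : ∀ i q → w i (σ i q) ≡ true
      σ-injective : ∀ {i i′} q q′ → σ i q ≡ σ i′ q′ → i ≡ i′

  inSpan-resp : ∀ {u u′} → u ≗ u′ → InSpan u → InSpan u′
  inSpan-resp u≗u′ (d , sd , eq) = d , sd , λ j → trans (eq j) (u≗u′ j)

  inSpan-∅ : InSpan ∅
  inSpan-∅ = ∅ , (λ _ ()) , linComb-∅ w (λ _ → refl)

  inSpan-⊕ : ∀ {u u′} → InSpan u → InSpan u′ → InSpan (u ⊕ u′)
  inSpan-⊕ (d , sd , eq) (d′ , sd′ , eq′) =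
    d ⊕ d′ , supported , λ j → trans (linComb-⊕ w d d′ j) (cong₂ _xor_ (eq j) (eq′ j))
    where
    supported : Supported (d ⊕ d′)
    supported i d⊕d′≡true with d i in di
    ... | true  = sd i di
    ... | false = sd′ i d⊕d′≡true

  inSpan-linComb : ∀ {t} (v : Fin t → Fin R → Bool) d →
    (∀ s → d s ≡ true → InSpan (v s)) → InSpan (linComb v d)
  inSpan-linComb {zero}  v d _ = inSpan-∅
  inSpan-linComb {suc t} v d vs∈span =
    inSpan-⊕ first∈span (inSpan-linComb (v ∘ suc) (d ∘ suc) (vs∈span ∘ suc))
    where
    first∈span : InSpan (λ j → d zero ∧ v zero j)
    first∈span with d zero in d0
    ... | true  = vs∈span zero d0
    ... | false = inSpan-∅

  inSpan-units : ∀ u → (∀ j → u j ≡ true → InSpan ⁅ j ⁆) → InSpan u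
  inSpan-units u units∈span = inSpan-resp u-expansion (inSpan-linComb ⁅_⁆ u units∈span)
    where
    u-expansion : linComb ⁅_⁆ u ≗ u
    u-expansion x = trans (xorFin-cong R (λ j → trans (∧-comm (u j) _) (cong (_∧ u j) (⁅⁆-comm x j))))
                          (xorFin-⁅⁆ R x u)

  inSpan? : ∀ u → Dec (InSpan u)
  inSpan? u = map′ fromSubset toSubset (anySubset? λ s → supported? (lookup s) ×-dec ≗? (lookup s))
    where
    supported? : ∀ d → Dec (Supported d)
    supported? d = all? (λ i → (d i Bool.≟ true) →-dec (Q i Bool.≟ true))
    ≗? : ∀ d → Dec (linComb w d ≗ u)
    ≗? d = all? (λ j → linComb w d j Bool.≟ u j)
    fromSubset : ∃[ s ] Supported (lookup s) × linComb w (lookup s) ≗ u → InSpan u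
    fromSubset (s , p) = lookup s , p
    toSubset : InSpan u → ∃[ s ] Supported (lookup s) × linComb w (lookup s) ≗ u
    toSubset (d , sd , eq) = tabulate d , (λ i → sd i ∘ trans (sym (lookup∘tabulate d i))) ,
      λ j → trans (linComb-cong w (lookup∘tabulate d) j) (eq j)

module _ {k R : ℕ} where

  maskColumn : (Fin k → Fin R → Bool) → Fin R → Fin k → Fin R → Bool
  maskColumn v j i t = v i t ∧ not (⁅ j ⁆ t)

  linComb-maskColumn : ∀ v j d t → linComb (maskColumn v j) d t ≡ linComb v d t ∧ not (⁅ j ⁆ t)
  linComb-maskColumn v j d t = begin
    xorFin k (λ i → d i ∧ (v i t ∧ not (⁅ j ⁆ t)))
      ≡⟨ xorFin-cong k (λ i → ∧-rotate (d i) (v i t) _) ⟩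
    xorFin k (λ i → not (⁅ j ⁆ t) ∧ (d i ∧ v i t))
      ≡⟨ xorFin-∧ˡ k _ _ ⟩
    not (⁅ j ⁆ t) ∧ linComb v d t
      ≡⟨ ∧-comm (not (⁅ j ⁆ t)) _ ⟩
    linComb v d t ∧ not (⁅ j ⁆ t) ∎
    where open ≡-Reasoning

  independent-maskColumn : ∀ {v Q j} → LinearlyIndependent v Q → ¬ InSpan v Q ⁅ j ⁆ →
    LinearlyIndependent (maskColumn v j) Q
  independent-maskColumn {v} {Q} {j} independent ⁅j⁆∉span d sd masked≗∅ =
    independent d sd vanishes
    where
    vanishes-off-j : ∀ t → t ≢ j → linComb v d t ≡ false
    vanishes-off-j t t≢j = begin
      linComb v d t                  ≡⟨ sym (∧-identityʳ _) ⟩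
      linComb v d t ∧ true           ≡⟨ cong (λ b → linComb v d t ∧ not b) (sym (⁅⁆-other (≢-sym t≢j))) ⟩
      linComb v d t ∧ not (⁅ j ⁆ t)  ≡⟨ sym (linComb-maskColumn v j d t) ⟩
      linComb (maskColumn v j) d t   ≡⟨ masked≗∅ t ⟩
      false                          ∎
      where open ≡-Reasoning
    vanishes : linComb v d ≗ ∅
    vanishes t with t ≟ j
    ... | no t≢j = vanishes-off-j t t≢j
    ... | yes refl with linComb v d t in value
    ...   | false = refl
    ...   | true  = contradiction (d , sd , is-unit) ⁅j⁆∉span
      where
      is-unit : linComb v d ≗ ⁅ t ⁆
      is-unit t′ with t ≟ t′
      ... | yes refl = value
      ... | no t≢t′  = vanishes-off-j t′ (≢-sym t≢t′)

module _ {k R : ℕ} (w : Fin (suc k) → Fin R → Bool) (Q : Fin (suc k) → Bool) where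

  independent-otherRows : LinearlyIndependent w Q → LinearlyIndependent (w ∘ suc) (Q ∘ suc)
  independent-otherRows independent d sd eq i = independent (false ∷ d) supported eq (suc i)
    where
    supported : Supported w Q (false ∷ d)
    supported (suc i) = sd i

  firstRow-∉-span : LinearlyIndependent w Q → Q zero ≡ true → ¬ InSpan (w ∘ suc) (Q ∘ suc) (w zero)
  firstRow-∉-span independent q0 (d , sd , eq) =
    contradiction (independent (true ∷ d) supported vanishes zero) λ ()
    where
    supported : Supported w Q (true ∷ d)
    supported zero    _ = q0
    supported (suc i) = sd i
    vanishes : linComb w (true ∷ d) ≗ ∅
    vanishes x = trans (cong (w zero x xor_) (eq x)) (xor-same (w zero x))

  transversal-skip : Q zero ≡ false → Transversal (w ∘ suc) (Q ∘ suc) → Transversal w Q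
  transversal-skip q0 T = record { σ = σ ; σ-hits = σ-hits ; σ-injective = σ-injective }
    where
    open Transversal T renaming (σ to σ′; σ-hits to σ′-hits; σ-injective to σ′-injective)
    σ : (i : Fin (suc k)) → Q i ≡ true → Fin R
    σ zero    q = contradiction (trans (sym q) q0) λ ()
    σ (suc i) q = σ′ i q
    σ-hits : ∀ i q → w i (σ i q) ≡ true
    σ-hits zero    q = contradiction (trans (sym q) q0) λ ()
    σ-hits (suc i) q = σ′-hits i q
    σ-injective : ∀ {i i′} q q′ → σ i q ≡ σ i′ q′ → i ≡ i′
    σ-injective {zero}  q _ _ = contradiction (trans (sym q) q0) λ ()
    σ-injective {suc _} {zero} _ q′ _ = contradiction (trans (sym q′) q0) λ ()
    σ-injective {suc _} {suc _} q q′ eq = cong suc (σ′-injective q q′ eq)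

  transversal-extend : ∀ {j} → w zero j ≡ true →
    Transversal (maskColumn (w ∘ suc) j) (Q ∘ suc) → Transversal w Q
  transversal-extend {j} w0j T = record { σ = σ ; σ-hits = σ-hits ; σ-injective = σ-injective }
    where
    open Transversal T renaming (σ to σ′; σ-hits to σ′-hits; σ-injective to σ′-injective)
    σ′-avoids-j : ∀ i q → σ′ i q ≢ j
    σ′-avoids-j i q σ′≡j = contradiction (begin
      false                  ≡⟨ cong not (sym (⁅⁆-self j)) ⟩
      not (⁅ j ⁆ j)          ≡⟨ cong (not ∘ ⁅ j ⁆) (sym σ′≡j) ⟩
      not (⁅ j ⁆ (σ′ i q))   ≡⟨ ∧-conicalʳ _ _ (σ′-hits i q) ⟩
      true                   ∎) λ ()
      where open ≡-Reasoning
    σ : (i : Fin (suc k)) → Q i ≡ true → Fin R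
    σ zero    _ = j
    σ (suc i) q = σ′ i q
    σ-hits : ∀ i q → w i (σ i q) ≡ true
    σ-hits zero    _ = w0j
    σ-hits (suc i) q = ∧-conicalˡ _ _ (σ′-hits i q)
    σ-injective : ∀ {i i′} q q′ → σ i q ≡ σ i′ q′ → i ≡ i′
    σ-injective {zero}  {zero}   _ _  _  = refl
    σ-injective {zero}  {suc i′} _ q′ eq = contradiction (sym eq) (σ′-avoids-j i′ q′)
    σ-injective {suc i} {zero}   q _  eq = contradiction eq (σ′-avoids-j i q)
    σ-injective {suc _} {suc _}  q q′ eq = cong suc (σ′-injective q q′ eq)

-- Pivot on a column j of the first row whose unit vector is not spanned by the
-- other rows (otherwise the first row itself would be spanned); masking column j
-- keeps the other rows independent.
independent⇒transversal : ∀ {k R} (w : Fin k → Fin R → Bool) Q →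
  LinearlyIndependent w Q → Transversal w Q
independent⇒transversal {zero} w Q _ =
  record { σ = λ () ; σ-hits = λ () ; σ-injective = λ { {()} } }
independent⇒transversal {suc k} {R} w Q independent with Q zero in q0
... | false = transversal-skip w Q q0 (independent⇒transversal _ _ (independent-otherRows w Q independent))
... | true with any? (λ j → (w zero j Bool.≟ true) ×-dec ¬? (inSpan? (w ∘ suc) (Q ∘ suc) ⁅ j ⁆))
...   | yes (j , w0j , ⁅j⁆∉span) = transversal-extend w Q w0j
        (independent⇒transversal _ _
          (independent-maskColumn {j = j} (independent-otherRows w Q independent) ⁅j⁆∉span))
...   | no no-pivot = contradiction
        (inSpan-units (w ∘ suc) (Q ∘ suc) (w zero) ⁅j⁆∈span) (firstRow-∉-span w Q independent q0)
  where
  ⁅j⁆∈span : ∀ j → w zero j ≡ true → InSpan (w ∘ suc) (Q ∘ suc) ⁅ j ⁆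
  ⁅j⁆∈span j w0j with inSpan? (w ∘ suc) (Q ∘ suc) ⁅ j ⁆
  ... | yes ⁅j⁆∈ = ⁅j⁆∈
  ... | no ⁅j⁆∉ = contradiction (j , w0j , ⁅j⁆∉) no-pivot

injective⇒surjective : ∀ {b} (f : Fin b → Fin b) → Injective _≡_ _≡_ f → ∀ y → ∃[ x ] f x ≡ y
injective⇒surjective {suc b} f f-injective y with any? (λ x → f x ≟ y)
... | yes hit = hit
... | no missed = contradiction (injective⇒≤ punchOut-injective′) ℕ.1+n≰n
  where
  y≢f : ∀ x → y ≢ f x
  y≢f x y≡fx = missed (x , sym y≡fx)
  punchOut-injective′ : Injective _≡_ _≡_ (λ x → punchOut (y≢f x))
  punchOut-injective′ eq = f-injective (punchOut-injective (y≢f _) (y≢f _) eq)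

injections⇒onto : ∀ {b} {A : Set} {P : A → Set}
  (f : Fin b → A) → (∀ i → P (f i)) → Injective _≡_ _≡_ f →
  (g : ∀ x → P x → Fin b) → (∀ {x y} p q → g x p ≡ g y q → x ≡ y) →
  ∀ x → P x → ∃[ i ] f i ≡ x
injections⇒onto f f∈P f-injective g g-injective x p =
  let i , gfi≡gx = injective⇒surjective (λ i → g (f i) (f∈P i))
                     (f-injective ∘ g-injective _ _) (g x p)
  in i , g-injective _ _ gfi≡gx

CycleFree : {A : Set} → (A → A → Set) → Set
CycleFree {A} _⟶_ = ∀ (h : ℕ → A) L → h 0 ≡ h (suc L) → ¬ (∀ t → t ≤ L → h t ⟶ h (suc t))

cycleFree-flip : ∀ {A} {_⟶_ : A → A → Set} → CycleFree _⟶_ → CycleFree (flip _⟶_)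
cycleFree-flip {_⟶_ = _⟶_} cycleFree h L h0≡hL backwards =
  cycleFree (λ t → h (suc L ∸ t)) L
    (trans (sym h0≡hL) (cong h (sym (ℕ.n∸n≡0 L)))) forwards
  where
  forwards : ∀ t → t ≤ L → h (suc L ∸ t) ⟶ h (L ∸ t)
  forwards t t≤L = subst (λ s → h s ⟶ h (L ∸ t)) (sym (ℕ.+-∸-assoc 1 t≤L))
                         (backwards (L ∸ t) (ℕ.m∸n≤m L t))

cycleFree⇒noLongWalk : ∀ {n} {_⟶_ : Fin n → Fin n → Set} → CycleFree _⟶_ →
  ∀ (g : ℕ → Fin n) → ¬ (∀ t → t < n → g t ⟶ g (suc t))
cycleFree⇒noLongWalk {n} {_⟶_} cycleFree g walk
  with i , j , i<j , gi≡gj ← pigeonhole (ℕ.n<1+n n) (g ∘ toℕ)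
  with L , i+1+L≡j ← ℕ.m≤n⇒∃[o]m+o≡n i<j
  = cycleFree (λ t → g (toℕ i + t)) L closed steps
  where
  closed : g (toℕ i + 0) ≡ g (toℕ i + suc L)
  closed = begin
    g (toℕ i + 0)      ≡⟨ cong g (ℕ.+-identityʳ (toℕ i)) ⟩
    g (toℕ i)          ≡⟨ gi≡gj ⟩
    g (toℕ j)          ≡⟨ cong g (sym (trans (ℕ.+-suc (toℕ i) L) i+1+L≡j)) ⟩
    g (toℕ i + suc L)  ∎
    where open ≡-Reasoning
  in-range : ∀ t → t ≤ L → toℕ i + t < n
  in-range t t≤L = begin-strict
    toℕ i + t      ≤⟨ ℕ.+-monoʳ-≤ (toℕ i) t≤L ⟩
    toℕ i + L      <⟨ ℕ.n<1+n _ ⟩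
    suc (toℕ i) + L ≡⟨ i+1+L≡j ⟩
    toℕ j          ≤⟨ s≤s⁻¹ (toℕ<n j) ⟩
    n              ∎
    where open ℕ.≤-Reasoning
  steps : ∀ t → t ≤ L → g (toℕ i + t) ⟶ g (toℕ i + suc t)
  steps t t≤L = subst (λ s → g (toℕ i + t) ⟶ g s) (sym (ℕ.+-suc (toℕ i) t)) (walk _ (in-range t t≤L))

module _ (G : Graph) where
  open Graph G

  ∂ : (Fin m → Bool) → Fin n → Bool
  ∂ = linComb (incident G)

  Even : (Fin m → Bool) → Set
  Even z = ∂ z ≗ ∅

  even⇒inCycleSpace : ∀ {z} → Even z → InCycleSpace G z
  even⇒inCycleSpace even v = xorFin-false⇒count-even m _ (even v)

  even-linComb : ∀ {k} (zs : Fin k → Fin m → Bool) c → (∀ i → Even (zs i)) → Even (linComb zs c)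
  even-linComb {k} zs c zs-even v = trans (linComb-linComb (incident G) zs c v)
    (xorFin-∅ k (λ i → trans (cong (c i ∧_) (zs-even i v)) (∧-zeroʳ (c i))))

  incident-src : ∀ e → incident G e (src e) ≡ true
  incident-src e with src e ≟ src e
  ... | yes _ = refl
  ... | no s≢s = contradiction refl s≢s

  incident-tgt : ∀ e → incident G e (tgt e) ≡ true
  incident-tgt e with src e ≟ tgt e | tgt e ≟ tgt e
  ... | yes _ | _     = refl
  ... | no _  | yes _ = refl
  ... | no _  | no t≢t = contradiction refl t≢t

  incident⇒endpoint : ∀ {e v} → incident G e v ≡ true → src e ≡ v ⊎ tgt e ≡ v
  incident⇒endpoint {e} {v} _ with src e ≟ v | tgt e ≟ v
  ... | yes s≡v | _     = inj₁ s≡v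
  ... | no _    | yes t≡v = inj₂ t≡v

  joins-cases : ∀ {e x y u w} → Joins G e x y → Joins G e u w → (x ≡ u × y ≡ w) ⊎ (x ≡ w × y ≡ u)
  joins-cases (inj₁ (refl , refl)) (inj₁ (refl , refl)) = inj₁ (refl , refl)
  joins-cases (inj₁ (refl , refl)) (inj₂ (refl , refl)) = inj₂ (refl , refl)
  joins-cases (inj₂ (refl , refl)) (inj₁ (refl , refl)) = inj₂ (refl , refl)
  joins-cases (inj₂ (refl , refl)) (inj₂ (refl , refl)) = inj₁ (refl , refl)

  ∂-⁅⁆ : (∀ e → src e ≢ tgt e) → ∀ {e u w} → Joins G e u w → ∂ ⁅ e ⁆ ≗ ⁅ u ⁆ ⊕ ⁅ w ⁆
  ∂-⁅⁆ loopless {e} (inj₁ (refl , refl)) v = trans (xorFin-⁅⁆ m e (λ e′ → incident G e′ v)) incident≗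
    where
    incident≗ : incident G e v ≡ ⁅ src e ⁆ v xor ⁅ tgt e ⁆ v
    incident≗ with src e ≟ v | tgt e ≟ v
    ... | yes refl | yes t≡v = contradiction (sym t≡v) (loopless e)
    ... | yes _    | no _    = refl
    ... | no _     | yes _   = refl
    ... | no _     | no _    = refl
  ∂-⁅⁆ loopless {e} (inj₂ (refl , refl)) v =
    trans (∂-⁅⁆ loopless (inj₁ (refl , refl)) v) (xor-comm (⁅ src e ⁆ v) _)

module _ (G : Graph) (simple : Simple G) where
  open Graph G

  joins-unique : ∀ {e e′ u w} → Joins G e u w → Joins G e′ u w → e ≡ e′
  joins-unique (inj₁ (refl , refl)) joins′ = proj₂ simple _ _ joins′
  joins-unique (inj₂ (refl , refl)) (inj₁ p) = proj₂ simple _ _ (inj₂ p)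
  joins-unique (inj₂ (refl , refl)) (inj₂ p) = proj₂ simple _ _ (inj₁ p)

  module _ (C : Cycle G) where
    open Cycle C

    private
      ℓ : ℕ
      ℓ = suc (suc len)

    edge : Fin ℓ → Fin m
    edge i = proj₁ (adj i)

    closingEdge : Fin m
    closingEdge = proj₁ adj₀

    edge-injective : Injective _≡_ _≡_ edge
    edge-injective {i} {j} eq
      with joins-cases G (proj₂ (adj i)) (subst (λ e → Joins G e _ _) (sym eq) (proj₂ (adj j)))
    ... | inj₁ (vi≡vj , _) = inject₁-injective (inj _ _ vi≡vj)
    ... | inj₂ (vi≡vj+1 , vi+1≡vj) = contradiction (begin
          toℕ j                ≡⟨ sym (toℕ-inject₁ j) ⟩
          toℕ (inject₁ j)      ≡⟨ cong toℕ (inj _ _ (sym vi+1≡vj)) ⟩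
          suc (toℕ i)          ≡⟨ cong suc (sym (toℕ-inject₁ i)) ⟩
          suc (toℕ (inject₁ i)) ≡⟨ cong (suc ∘ toℕ) (inj _ _ vi≡vj+1) ⟩
          suc (suc (toℕ j))    ∎) (ℕ.m≢1+n+m (toℕ j) {1})
      where open ≡-Reasoning

    edge≢closingEdge : ∀ i → edge i ≢ closingEdge
    edge≢closingEdge i eq
      with joins-cases G (proj₂ (adj i)) (subst (λ e → Joins G e _ _) (sym eq) (proj₂ adj₀))
    ... | inj₁ (vi≡vℓ , _) = contradiction (begin
          toℕ i               ≡⟨ sym (toℕ-inject₁ i) ⟩
          toℕ (inject₁ i)     ≡⟨ cong toℕ (inj _ _ vi≡vℓ) ⟩
          toℕ (fromℕ ℓ)       ≡⟨ toℕ-fromℕ ℓ ⟩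
          ℓ                   ∎) (ℕ.<⇒≢ (toℕ<n i))
      where open ≡-Reasoning
    ... | inj₂ (vi≡v0 , vi+1≡vℓ) = contradiction (begin
          1                   ≡⟨ cong suc (sym (trans (sym (toℕ-inject₁ i)) (cong toℕ (inj _ _ vi≡v0)))) ⟩
          suc (toℕ i)         ≡⟨ cong toℕ (inj _ _ vi+1≡vℓ) ⟩
          toℕ (fromℕ ℓ)       ≡⟨ toℕ-fromℕ ℓ ⟩
          ℓ                   ∎) λ ()
      where open ≡-Reasoning

    pathEdges : Fin m → Bool
    pathEdges = linComb (⁅_⁆ ∘ edge) (λ _ → true)

    pathEdges-edge : ∀ i → pathEdges (edge i) ≡ true
    pathEdges-edge i = begin
      xorFin ℓ (λ j → ⁅ edge j ⁆ (edge i)) ≡⟨ xorFin-cong ℓ (λ j → ⁅⁆-injective edge-injective j i) ⟩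
      xorFin ℓ (λ j → ⁅ j ⁆ i)             ≡⟨ xorFin-cong ℓ (λ j → ⁅⁆-comm i j) ⟩
      xorFin ℓ ⁅ i ⁆                       ≡⟨ xorFin-⁅⁆-true ℓ i ⟩
      true                                 ∎
      where open ≡-Reasoning

    pathEdges-other : ∀ {e} → (∀ i → edge i ≢ e) → pathEdges e ≡ false
    pathEdges-other edge≢e = xorFin-∅ ℓ (λ i → ⁅⁆-other (edge≢e i))

    edgeSet-≗ : edgeSet G C ≗ pathEdges ⊕ ⁅ closingEdge ⁆
    edgeSet-≗ e with any? (λ i → joins? G e (vtx (inject₁ i)) (vtx (suc i)))
                   | joins? G e (vtx (fromℕ ℓ)) (vtx zero)
    ... | yes (i , J) | yes J′ =
      contradiction (trans (sym (joins-unique J (proj₂ (adj i)))) (joins-unique J′ (proj₂ adj₀)))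
                    (edge≢closingEdge i)
    ... | yes (i , J) | no ¬J′ rewrite joins-unique J (proj₂ (adj i)) =
      sym (cong₂ _xor_ (pathEdges-edge i)
                       (⁅⁆-other (λ closing≡edge → ¬J′ (subst (λ e → Joins G e _ _) closing≡edge (proj₂ adj₀)))))
    ... | no ¬J | yes J′ rewrite joins-unique J′ (proj₂ adj₀) =
      sym (cong₂ _xor_ (pathEdges-other (edge≢closingEdge)) (⁅⁆-self closingEdge))
    ... | no ¬J | no ¬J′ =
      sym (cong₂ _xor_ (pathEdges-other λ i edge≡e → ¬J (i , subst (λ e → Joins G e _ _) edge≡e (proj₂ (adj i))))
                       (⁅⁆-other (λ closing≡e → ¬J′ (subst (λ e → Joins G e _ _) closing≡e (proj₂ adj₀)))))

    edgeSet-even : Even G (edgeSet G C)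
    edgeSet-even v = begin
      ∂ G (edgeSet G C) v
        ≡⟨ linComb-cong (incident G) edgeSet-≗ v ⟩
      ∂ G (pathEdges ⊕ ⁅ closingEdge ⁆) v
        ≡⟨ linComb-⊕ (incident G) pathEdges _ v ⟩
      ∂ G pathEdges v xor ∂ G ⁅ closingEdge ⁆ v
        ≡⟨ cong₂ _xor_ ∂-pathEdges (∂-⁅⁆ G loopless (proj₂ adj₀) v) ⟩
      (x₀ xor xℓ) xor (xℓ xor x₀)
        ≡⟨ xor-cancelMiddle x₀ xℓ x₀ ⟩
      x₀ xor x₀
        ≡⟨ xor-same x₀ ⟩
      false ∎
      where
      open ≡-Reasoning
      loopless : ∀ e → src e ≢ tgt e
      loopless = proj₁ simple
      x₀ xℓ : Bool
      x₀ = ⁅ vtx zero ⁆ v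
      xℓ = ⁅ vtx (fromℕ ℓ) ⁆ v
      ∂-pathEdges : ∂ G pathEdges v ≡ x₀ xor xℓ
      ∂-pathEdges = begin
        ∂ G pathEdges v
          ≡⟨ linComb-linComb (incident G) (⁅_⁆ ∘ edge) (λ _ → true) v ⟩
        xorFin ℓ (λ i → ∂ G ⁅ edge i ⁆ v)
          ≡⟨ xorFin-cong ℓ (λ i → ∂-⁅⁆ G loopless (proj₂ (adj i)) v) ⟩
        xorFin ℓ (λ i → ⁅ vtx (inject₁ i) ⁆ v xor ⁅ vtx (suc i) ⁆ v)
          ≡⟨ xorFin-telescope ℓ (λ j → ⁅ vtx j ⁆ v) ⟩
        x₀ xor xℓ ∎

    joins-endpoints : ∀ {e p q} → Joins G e (vtx p) (vtx q) → _∈V_ G (src e) C × _∈V_ G (tgt e) C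
    joins-endpoints {p = p} {q} (inj₁ (s≡ , t≡)) = (p , sym s≡) , (q , sym t≡)
    joins-endpoints {p = p} {q} (inj₂ (s≡ , t≡)) = (q , sym s≡) , (p , sym t≡)

    edgeSet-endpoints : ∀ {e} → edgeSet G C e ≡ true → _∈V_ G (src e) C × _∈V_ G (tgt e) C
    edgeSet-endpoints {e} _ with any? (λ i → joins? G e (vtx (inject₁ i)) (vtx (suc i)))
                               | joins? G e (vtx (fromℕ ℓ)) (vtx zero)
    ... | yes (_ , J) | _     = joins-endpoints J
    ... | no _        | yes J = joins-endpoints J

module Orientation (G : Graph) (loopless : ∀ e → Graph.src G e ≢ Graph.tgt G e)
                   (eρ : Fin (Graph.m G)) (δ : Fin (Graph.n G) → ℕ) (dir : Fin (Graph.m G) → Bool)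
                   (sat : SatisfiesConstraint G eρ δ dir) where
  open Graph G

  hd tl : Fin m → Fin n
  hd = head G dir
  tl = tail G dir

  _⇒_ : Fin n → Fin n → Set
  u ⇒ v = Arc G eρ dir (just u) (just v)

  cycleFree : CycleFree _⇒_
  cycleFree h L h0≡hL steps = proj₁ (proj₁ sat) L (λ i → just (h (toℕ i))) closed steps′
    where
    closed : just (h 0) ≡ just (h (toℕ (fromℕ (suc L))))
    closed = cong just (trans h0≡hL (cong h (sym (toℕ-fromℕ (suc L)))))
    steps′ : ∀ i → h (toℕ (inject₁ i)) ⇒ h (suc (toℕ i))
    steps′ i = subst (λ t → h t ⇒ h (suc (toℕ i))) (sym (toℕ-inject₁ i))
                     (steps (toℕ i) (s≤s⁻¹ (toℕ<n i)))

  joins-tl-hd : ∀ e → Joins G e (tl e) (hd e)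
  joins-tl-hd e with dir e
  ... | true  = inj₁ (refl , refl)
  ... | false = inj₂ (refl , refl)

  incident-hd : ∀ e → incident G e (hd e) ≡ true
  incident-hd e with dir e
  ... | true  = incident-tgt G e
  ... | false = incident-src G e

  incident⇒tl : ∀ {e v} → incident G e v ≡ true → hd e ≢ v → tl e ≡ v
  incident⇒tl {e} incident≡true hd≢v with dir e | incident⇒endpoint G incident≡true
  ... | true  | inj₁ s≡v = s≡v
  ... | true  | inj₂ t≡v = contradiction t≡v hd≢v
  ... | false | inj₁ s≡v = contradiction s≡v hd≢v
  ... | false | inj₂ t≡v = t≡v

  isReticulation : Fin n → Bool
  isReticulation v = does (δ v ℕ.≟ 2)

  reticulation⇒δ≡2 : ∀ {v} → isReticulation v ≡ true → δ v ≡ 2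
  reticulation⇒δ≡2 {v} = does⇒ (δ v ℕ.≟ 2)

  δ≡2⇒reticulation : ∀ {v} → δ v ≡ 2 → isReticulation v ≡ true
  δ≡2⇒reticulation {v} = dec-true (δ v ℕ.≟ 2)

  onRootEdge : Fin n → Bool
  onRootEdge = incident G eρ

  incoming : Fin n → Fin m → Bool
  incoming v e = notRoot G eρ e ∧ ⌊ hd e ≟ v ⌋

  incoming⇒ : ∀ {v e} → incoming v e ≡ true → e ≢ eρ × hd e ≡ v
  incoming⇒ {v} {e} _ with e ≟ eρ | hd e ≟ v
  ... | no e≢eρ | yes hd≡v = e≢eρ , hd≡v

  incoming-hd : ∀ {e} → e ≢ eρ → incoming (hd e) e ≡ true
  incoming-hd {e} e≢eρ with e ≟ eρ | hd e ≟ hd e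
  ... | yes e≡eρ | _          = contradiction e≡eρ e≢eρ
  ... | no _     | yes _      = refl
  ... | no _     | no hd≢hd   = contradiction refl hd≢hd

  indeg-reticulation : ∀ v → isReticulation v ≡ true → ind (onRootEdge v) + count m (incoming v) ≡ 2
  indeg-reticulation v ret = trans (proj₂ sat v) (reticulation⇒δ≡2 ret)

  indeg-other : ∀ v → isReticulation v ≡ false → ind (onRootEdge v) + count m (incoming v) ≡ 1
  indeg-other v ¬ret with proj₂ (proj₁ sat) v
  ... | inj₁ (indeg≡1 , _)        = indeg≡1
  ... | inj₂ (inj₁ (indeg≡2 , _)) =
    contradiction (trans (sym (δ≡2⇒reticulation (trans (sym (proj₂ sat v)) indeg≡2))) ¬ret) λ ()
  ... | inj₂ (inj₂ (indeg≡1 , _)) = indeg≡1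

  -- Junk value eρ when no arc satisfies f.
  pick : (Fin m → Bool) → Fin m
  pick f with any? (λ e → f e Bool.≟ true)
  ... | yes (e , _) = e
  ... | no _        = eρ

  pick-true : ∀ (f : Fin m → Bool) → ∃[ e ] f e ≡ true → f (pick f) ≡ true
  pick-true f found with any? (λ e → f e Bool.≟ true)
  ... | yes (_ , fe) = fe
  ... | no none      = contradiction found none

  -- The non-root arcs other than the nonTreeArc r of reticulations r are the tree arcs
  -- (isTreeArcInto below); together with eρ they form a spanning tree.
  nonTreeArc : Fin n → Fin m
  nonTreeArc r = pick (incoming r)

  nonTreeArc-incoming : ∀ {r} → isReticulation r ≡ true → incoming r (nonTreeArc r) ≡ true
  nonTreeArc-incoming {r} ret
    with onRootEdge r | indeg-reticulation r ret
  ... | true  | 1+count≡2 = pick-true (incoming r) (count-nonzero m (incoming r) (ℕ.suc-injective 1+count≡2))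
  ... | false | count≡2   = pick-true (incoming r) (count-nonzero m (incoming r) count≡2)

  nonTreeArc≢eρ : ∀ {r} → isReticulation r ≡ true → nonTreeArc r ≢ eρ
  nonTreeArc≢eρ = proj₁ ∘ incoming⇒ ∘ nonTreeArc-incoming

  hd-nonTreeArc : ∀ {r} → isReticulation r ≡ true → hd (nonTreeArc r) ≡ r
  hd-nonTreeArc = proj₂ ∘ incoming⇒ ∘ nonTreeArc-incoming

  isTreeArcInto : Fin n → Fin m → Bool
  isTreeArcInto v e = incoming v e ∧ not (isReticulation v ∧ ⁅ nonTreeArc v ⁆ e)

  treeArcsInto-count : ∀ v → ind (onRootEdge v) + count m (isTreeArcInto v) ≡ 1
  treeArcsInto-count v = by-type (isReticulation v) refl
    where
    by-type : ∀ b → isReticulation v ≡ b → ind (onRootEdge v) + count m (isTreeArcInto v) ≡ 1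
    by-type true ret = ℕ.suc-injective (begin
      suc (ind (onRootEdge v) + count m (isTreeArcInto v)) ≡⟨ sym (ℕ.+-suc _ _) ⟩
      ind (onRootEdge v) + suc (count m (isTreeArcInto v)) ≡⟨ cong (ind (onRootEdge v) +_) (sym count-incoming) ⟩
      ind (onRootEdge v) + count m (incoming v)            ≡⟨ indeg-reticulation v ret ⟩
      2                                                    ∎)
      where
      open ≡-Reasoning
      count-incoming : count m (incoming v) ≡ suc (count m (isTreeArcInto v))
      count-incoming = trans (count-remove m (incoming v) (nonTreeArc-incoming ret))
        (cong suc (count-cong m (λ e → cong (λ b → incoming v e ∧ not (b ∧ ⁅ nonTreeArc v ⁆ e)) (sym ret))))
    by-type false ¬ret = trans (cong (ind (onRootEdge v) +_) (sym (count-cong m incoming≗))) (indeg-other v ¬ret)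
      where
      incoming≗ : incoming v ≗ isTreeArcInto v
      incoming≗ e = trans (sym (∧-identityʳ (incoming v e)))
                          (cong (λ b → incoming v e ∧ not (b ∧ ⁅ nonTreeArc v ⁆ e)) (sym ¬ret))

  treeArc : Fin n → Fin m
  treeArc v = pick (isTreeArcInto v)

  treeArc-isTreeArcInto : ∀ {v} → onRootEdge v ≡ false → isTreeArcInto v (treeArc v) ≡ true
  treeArc-isTreeArcInto {v} ¬end = pick-true (isTreeArcInto v)
    (count-nonzero m (isTreeArcInto v)
      (subst (λ b → ind b + count m (isTreeArcInto v) ≡ 1) ¬end (treeArcsInto-count v)))

  isTreeArcInto-unique : ∀ {v e} → isTreeArcInto v e ≡ true → onRootEdge v ≡ false × treeArc v ≡ e
  isTreeArcInto-unique {v} {e} tree with onRootEdge v in end | treeArcsInto-count v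
  ... | true  | 1+count≡1 =
    contradiction (trans (sym (count-remove m (isTreeArcInto v) tree)) (ℕ.suc-injective 1+count≡1)) λ ()
  ... | false | count≡1   = refl , count-one-unique m (isTreeArcInto v) count≡1 (treeArc-isTreeArcInto end) tree

  isTreeArcInto⇒ : ∀ {v e} → isTreeArcInto v e ≡ true →
    incoming v e ≡ true × (isReticulation v ≡ true → nonTreeArc v ≢ e)
  isTreeArcInto⇒ {v} {e} tree = ∧-conicalˡ _ _ tree , excluded
    where
    excluded : isReticulation v ≡ true → nonTreeArc v ≢ e
    excluded ret nonTree≡e = contradiction (begin
      false
        ≡⟨ cong₂ (λ x y → not (x ∧ y)) (sym ret) (sym ⁅nonTree⁆e) ⟩
      not (isReticulation v ∧ ⁅ nonTreeArc v ⁆ e)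
        ≡⟨ ∧-conicalʳ _ _ tree ⟩
      true ∎) λ ()
      where
      open ≡-Reasoning
      ⁅nonTree⁆e : ⁅ nonTreeArc v ⁆ e ≡ true
      ⁅nonTree⁆e = trans (cong (λ a → ⁅ a ⁆ e) nonTree≡e) (⁅⁆-self e)

  isTreeArcInto-intro : ∀ {e} → e ≢ eρ → (isReticulation (hd e) ≡ true → nonTreeArc (hd e) ≢ e) →
    isTreeArcInto (hd e) e ≡ true
  isTreeArcInto-intro {e} e≢eρ nonTree≢e = cong₂ _∧_ (incoming-hd e≢eρ) (cong not excluded)
    where
    excluded : isReticulation (hd e) ∧ ⁅ nonTreeArc (hd e) ⁆ e ≡ false
    excluded with isReticulation (hd e)
    ... | true  = ⁅⁆-other (nonTree≢e refl)
    ... | false = refl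

  hd-treeArc : ∀ {v} → onRootEdge v ≡ false → hd (treeArc v) ≡ v
  hd-treeArc = proj₂ ∘ incoming⇒ ∘ proj₁ ∘ isTreeArcInto⇒ ∘ treeArc-isTreeArcInto

  treeArc-arc : ∀ {v} → onRootEdge v ≡ false → tl (treeArc v) ⇒ v
  treeArc-arc {v} ¬end = subst (tl (treeArc v) ⇒_) (hd-treeArc ¬end) (edgeArc (treeArc v) treeArc≢eρ)
    where
    treeArc≢eρ : treeArc v ≢ eρ
    treeArc≢eρ = proj₁ (incoming⇒ (proj₁ (isTreeArcInto⇒ (treeArc-isTreeArcInto ¬end))))

  treeArc≢nonTreeArc : ∀ {v r} → onRootEdge v ≡ false → isReticulation r ≡ true → treeArc v ≢ nonTreeArc r
  treeArc≢nonTreeArc {v} {r} ¬end ret tree≡nonTree =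
    proj₂ (isTreeArcInto⇒ (treeArc-isTreeArcInto ¬end)) (subst (λ x → isReticulation x ≡ true) r≡v ret)
          (sym (trans tree≡nonTree (cong nonTreeArc r≡v)))
    where
    r≡v : r ≡ v
    r≡v = trans (sym (hd-nonTreeArc ret)) (trans (cong hd (sym tree≡nonTree)) (hd-treeArc ¬end))

  AvoidsNonTreeArcs : (Fin m → Bool) → Set
  AvoidsNonTreeArcs z = ∀ r → isReticulation r ≡ true → z (nonTreeArc r) ≡ false

  module _ {z : Fin m → Bool} (even : Even G z) (avoids : AvoidsNonTreeArcs z) where
    private
      ArcOf-z : Set
      ArcOf-z = Σ (Fin m) λ e → e ≢ eρ × z e ≡ true

      isTreeArc : ∀ {e} → e ≢ eρ → z e ≡ true → isTreeArcInto (hd e) e ≡ true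
      isTreeArc e≢eρ ze = isTreeArcInto-intro e≢eρ λ ret nonTree≡e →
        contradiction (trans (sym ze) (trans (cong z (sym nonTree≡e)) (avoids _ ret))) λ ()

      next : (x : ArcOf-z) → Σ ArcOf-z λ y → hd (proj₁ x) ⇒ hd (proj₁ y)
      next (e , e≢eρ , ze)
        with e′ , e′≢e , ze′∧incident ← xorFin-false⇒another m (λ e′ → z e′ ∧ incident G e′ (hd e)) (even (hd e))
                                          (trans (cong (_∧ incident G e (hd e)) ze) (incident-hd e))
        = (e′ , e′≢eρ , ze′) , subst (_⇒ hd e′) tl≡hd (edgeArc e′ e′≢eρ)
        where
        ze′ : z e′ ≡ true
        ze′ = ∧-conicalˡ _ _ ze′∧incident
        incident′ : incident G e′ (hd e) ≡ true
        incident′ = ∧-conicalʳ _ _ ze′∧incident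
        e-unique : onRootEdge (hd e) ≡ false × treeArc (hd e) ≡ e
        e-unique = isTreeArcInto-unique (isTreeArc e≢eρ ze)
        e′≢eρ : e′ ≢ eρ
        e′≢eρ refl = contradiction (trans (sym incident′) (proj₁ e-unique)) λ ()
        hd′≢hd : hd e′ ≢ hd e
        hd′≢hd hd′≡hd = e′≢e (trans (sym (proj₂ (isTreeArcInto-unique tree′))) (proj₂ e-unique))
          where
          tree′ : isTreeArcInto (hd e) e′ ≡ true
          tree′ = subst (λ x → isTreeArcInto x e′ ≡ true) hd′≡hd (isTreeArc e′≢eρ ze′)
        tl≡hd : tl e′ ≡ hd e
        tl≡hd = incident⇒tl incident′ hd′≢hd

      start : ∀ {e} → z e ≡ true → ArcOf-z
      start {e} ze with e ≟ eρ
      ... | no e≢eρ = e , e≢eρ , ze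
      ... | yes refl =
        let e′ , e′≢eρ , both = xorFin-false⇒another m (λ e′ → z e′ ∧ incident G e′ (src eρ)) (even (src eρ))
                                  (trans (cong (_∧ incident G eρ (src eρ)) ze) (incident-src G eρ))
        in e′ , e′≢eρ , ∧-conicalˡ _ _ both

    -- An arc of z enters a vertex as its tree arc, and evenness there yields another
    -- arc of z leaving that vertex: z would contain arbitrarily long directed walks.
    even∧avoidsNonTreeArcs⇒∅ : z ≗ ∅
    even∧avoidsNonTreeArcs⇒∅ e with z e in ze
    ... | false = refl
    ... | true  = contradiction (λ t _ → proj₂ (next (walk t)))
                                (cycleFree⇒noLongWalk {_⟶_ = _⇒_} cycleFree (hd ∘ proj₁ ∘ walk))
      where
      walk : ℕ → ArcOf-z
      walk zero    = start ze
      walk (suc t) = proj₁ (next (walk t))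

  RootPath : Fin n → (Fin m → Bool) → Set
  RootPath v z = ∂ G z ≗ ⁅ src eρ ⁆ ⊕ ⁅ v ⁆ × AvoidsNonTreeArcs z

  rootPath-onRootEdge : ∀ {v} → onRootEdge v ≡ true → ∃ (RootPath v)
  rootPath-onRootEdge end with incident⇒endpoint G end
  ... | inj₁ refl =
    ∅ , (λ w → trans (linComb-∅ (incident G) (λ _ → refl) w) (sym (xor-same (⁅ src eρ ⁆ w)))) , λ _ _ → refl
  ... | inj₂ refl =
    ⁅ eρ ⁆ , ∂-⁅⁆ G loopless (inj₁ (refl , refl)) , λ _ ret → ⁅⁆-other (≢-sym (nonTreeArc≢eρ ret))

  rootPath-extend : ∀ {v z} → onRootEdge v ≡ false → RootPath (tl (treeArc v)) z →
    RootPath v (z ⊕ ⁅ treeArc v ⁆)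
  rootPath-extend {v} {z} ¬end (∂z≗ , avoids) = boundary , avoids′
    where
    p : Fin m
    p = treeArc v
    boundary : ∂ G (z ⊕ ⁅ p ⁆) ≗ ⁅ src eρ ⁆ ⊕ ⁅ v ⁆
    boundary w = begin
      ∂ G (z ⊕ ⁅ p ⁆) w
        ≡⟨ linComb-⊕ (incident G) z ⁅ p ⁆ w ⟩
      ∂ G z w xor ∂ G ⁅ p ⁆ w
        ≡⟨ cong₂ _xor_ (∂z≗ w) (∂-⁅⁆ G loopless (joins-tl-hd p) w) ⟩
      (⁅ src eρ ⁆ w xor ⁅ tl p ⁆ w) xor (⁅ tl p ⁆ w xor ⁅ hd p ⁆ w)
        ≡⟨ xor-cancelMiddle (⁅ src eρ ⁆ w) (⁅ tl p ⁆ w) _ ⟩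
      ⁅ src eρ ⁆ w xor ⁅ hd p ⁆ w
        ≡⟨ cong (λ x → ⁅ src eρ ⁆ w xor ⁅ x ⁆ w) (hd-treeArc ¬end) ⟩
      ⁅ src eρ ⁆ w xor ⁅ v ⁆ w ∎
      where open ≡-Reasoning
    avoids′ : AvoidsNonTreeArcs (z ⊕ ⁅ p ⁆)
    avoids′ r ret = cong₂ _xor_ (avoids r ret) (⁅⁆-other (treeArc≢nonTreeArc ¬end ret))

  rootPath-or-backwardWalk : ∀ k v →
    ∃ (RootPath v) ⊎ ∃ λ (g : ℕ → Fin n) → g 0 ≡ v × (∀ t → t < k → g (suc t) ⇒ g t)
  rootPath-or-backwardWalk zero v = inj₂ ((λ _ → v) , refl , λ _ ())
  rootPath-or-backwardWalk (suc k) v with onRootEdge v in end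
  ... | true  = inj₁ (rootPath-onRootEdge end)
  ... | false with rootPath-or-backwardWalk k (tl (treeArc v))
  ...   | inj₁ (z , path)        = inj₁ (z ⊕ ⁅ treeArc v ⁆ , rootPath-extend end path)
  ...   | inj₂ (g , g0≡ , walk) = inj₂ (g′ , refl , walk′)
    where
    g′ : ℕ → Fin n
    g′ zero    = v
    g′ (suc t) = g t
    walk′ : ∀ t → t < suc k → g′ (suc t) ⇒ g′ t
    walk′ zero    _         = subst (_⇒ v) (sym g0≡) (treeArc-arc end)
    walk′ (suc t) (s≤s t<k) = walk t t<k

  rootPath : ∀ v → ∃ (RootPath v)
  rootPath v with rootPath-or-backwardWalk n v
  ... | inj₁ path           = path
  ... | inj₂ (g , _ , walk) =
    ⊥-elim (cycleFree⇒noLongWalk {_⟶_ = flip _⇒_} (cycleFree-flip {_⟶_ = _⇒_} cycleFree) g walk)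

  fundamentalCycle : Fin n → Fin m → Bool
  fundamentalCycle r =
    proj₁ (rootPath r) ⊕ (proj₁ (rootPath (tl (nonTreeArc r))) ⊕ ⁅ nonTreeArc r ⁆)

  fundamentalCycle-even : ∀ {r} → isReticulation r ≡ true → Even G (fundamentalCycle r)
  fundamentalCycle-even {r} ret w = begin
    ∂ G (P ⊕ (P′ ⊕ ⁅ a ⁆)) w
      ≡⟨ linComb-⊕ (incident G) P _ w ⟩
    ∂ G P w xor ∂ G (P′ ⊕ ⁅ a ⁆) w
      ≡⟨ cong (∂ G P w xor_) (linComb-⊕ (incident G) P′ ⁅ a ⁆ w) ⟩
    ∂ G P w xor (∂ G P′ w xor ∂ G ⁅ a ⁆ w)
      ≡⟨ cong₂ _xor_ (proj₁ (proj₂ (rootPath r)) w)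
                     (cong₂ _xor_ (proj₁ (proj₂ (rootPath (tl a))) w) (∂-⁅⁆ G loopless (joins-tl-hd a) w)) ⟩
    (s xor ⁅ r ⁆ w) xor ((s xor ⁅ tl a ⁆ w) xor (⁅ tl a ⁆ w xor ⁅ hd a ⁆ w))
      ≡⟨ cong ((s xor ⁅ r ⁆ w) xor_) (xor-cancelMiddle s _ _) ⟩
    (s xor ⁅ r ⁆ w) xor (s xor ⁅ hd a ⁆ w)
      ≡⟨ cong (λ x → (s xor ⁅ r ⁆ w) xor (s xor ⁅ x ⁆ w)) (hd-nonTreeArc ret) ⟩
    (s xor ⁅ r ⁆ w) xor (s xor ⁅ r ⁆ w)
      ≡⟨ xor-same (s xor ⁅ r ⁆ w) ⟩
    false ∎
    where
    open ≡-Reasoning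
    a : Fin m
    a = nonTreeArc r
    P P′ : Fin m → Bool
    P = proj₁ (rootPath r)
    P′ = proj₁ (rootPath (tl a))
    s : Bool
    s = ⁅ src eρ ⁆ w

  fundamentalCycle-nonTreeArc : ∀ {r r′} → isReticulation r ≡ true → isReticulation r′ ≡ true →
    fundamentalCycle r (nonTreeArc r′) ≡ ⁅ r ⁆ r′
  fundamentalCycle-nonTreeArc {r} {r′} ret ret′ =
    cong₂ _xor_ (proj₂ (proj₂ (rootPath r)) r′ ret′)
                (cong₂ _xor_ (proj₂ (proj₂ (rootPath (tl (nonTreeArc r)))) r′ ret′) ⁅nonTreeArc⁆)
    where
    ⁅nonTreeArc⁆ : ⁅ nonTreeArc r ⁆ (nonTreeArc r′) ≡ ⁅ r ⁆ r′
    ⁅nonTreeArc⁆ with r ≟ r′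
    ... | yes refl = ⁅⁆-self (nonTreeArc r)
    ... | no r≢r′  =
      ⁅⁆-other λ eq → r≢r′ (trans (sym (hd-nonTreeArc ret)) (trans (cong hd eq) (hd-nonTreeArc ret′)))

module CycleBasisMatching (G : Graph) (simple : Simple G) (eρ : Fin (Graph.m G)) (δ : Fin (Graph.n G) → ℕ)
                          (dir : Fin (Graph.m G) → Bool) (sat : SatisfiesConstraint G eρ δ dir)
                          {b : ℕ} (S : Fin b → Cycle G) (basis : IsCycleBasis G b S) where
  open Graph G
  open Orientation G (proj₁ simple) eρ δ dir sat

  meets : Fin b → Fin n → Bool
  meets i r = edgeSet G (S i) (nonTreeArc r)

  meetsReticulation : Fin b → Fin n → Bool
  meetsReticulation i r = isReticulation r ∧ meets i r

  basis-independent : LinearlyIndependent meetsReticulation (λ _ → true)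
  basis-independent c _ vanishes =
    proj₁ basis c
      (even∧avoidsNonTreeArcs⇒∅ (even-linComb G (edgeSet G ∘ S) c (edgeSet-even G simple ∘ S)) avoids)
    where
    avoids : AvoidsNonTreeArcs (linComb (edgeSet G ∘ S) c)
    avoids r ret = trans (xorFin-cong b (λ i → cong (λ x → c i ∧ (x ∧ meets i r)) (sym ret))) (vanishes r)

  -- Pairing a vanishing combination of the rows with the coordinates of the
  -- fundamental cycle of r₀ gives both d r₀ and 0.
  nonTreeArcs-independent : LinearlyIndependent (flip meets) isReticulation
  nonTreeArcs-independent d supported vanishes r₀ with d r₀ in d₀
  ... | false = refl
  ... | true
    with c , c-coordinates ← proj₂ basis (fundamentalCycle r₀)
                               (even⇒inCycleSpace G (fundamentalCycle-even (supported r₀ d₀)))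
    = contradiction (trans (sym pairing≡true) pairing≡false) λ ()
    where
    pairing : Bool
    pairing = xorFin n (λ r → d r ∧ fundamentalCycle r₀ (nonTreeArc r))
    pairing≡true : pairing ≡ true
    pairing≡true = begin
      pairing                           ≡⟨ xorFin-cong n on-support ⟩
      xorFin n (λ r → ⁅ r₀ ⁆ r ∧ d r)   ≡⟨ xorFin-⁅⁆ n r₀ d ⟩
      d r₀                              ≡⟨ d₀ ⟩
      true                              ∎
      where
      open ≡-Reasoning
      on-support : ∀ r → d r ∧ fundamentalCycle r₀ (nonTreeArc r) ≡ ⁅ r₀ ⁆ r ∧ d r
      on-support r with d r in dr
      ... | false = sym (∧-zeroʳ (⁅ r₀ ⁆ r))
      ... | true  = trans (fundamentalCycle-nonTreeArc (supported r₀ d₀) (supported r dr))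
                          (sym (∧-identityʳ _))
    pairing≡false : pairing ≡ false
    pairing≡false = begin
      pairing
        ≡⟨ xorFin-cong n (λ r → cong (d r ∧_) (sym (c-coordinates (nonTreeArc r)))) ⟩
      xorFin n (λ r → d r ∧ xorFin b (λ i → c i ∧ meets i r))
        ≡⟨ xorFin-∧-swap b n c d meets ⟩
      xorFin b (λ i → c i ∧ linComb (flip meets) d i)
        ≡⟨ xorFin-∅ b (λ i → trans (cong (c i ∧_) (vanishes i)) (∧-zeroʳ (c i))) ⟩
      false ∎
      where open ≡-Reasoning

  rowTransversal : Transversal meetsReticulation (λ _ → true)
  rowTransversal = independent⇒transversal meetsReticulation (λ _ → true) basis-independent

  columnTransversal : Transversal (flip meets) isReticulation
  columnTransversal = independent⇒transversal (flip meets) isReticulation nonTreeArcs-independent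

  reticulationOf : Fin b → Fin n
  reticulationOf i = Transversal.σ rowTransversal i refl

  reticulationOf-isReticulation : ∀ i → isReticulation (reticulationOf i) ≡ true
  reticulationOf-isReticulation i = ∧-conicalˡ _ _ (Transversal.σ-hits rowTransversal i refl)

  reticulationOf-injective : Injective _≡_ _≡_ reticulationOf
  reticulationOf-injective = Transversal.σ-injective rowTransversal refl refl

  reticulationOf-onto : ∀ r → isReticulation r ≡ true → ∃[ i ] reticulationOf i ≡ r
  reticulationOf-onto = injections⇒onto reticulationOf reticulationOf-isReticulation reticulationOf-injective
                                        (Transversal.σ columnTransversal) (Transversal.σ-injective columnTransversal)

  reticulationOf-∈V : ∀ i → _∈V_ G (reticulationOf i) (S i)
  reticulationOf-∈V i = subst (λ v → _∈V_ G v (S i)) (hd-nonTreeArc (reticulationOf-isReticulation i))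
    (hd-∈V (edgeSet-endpoints G simple (S i) (∧-conicalʳ _ _ (Transversal.σ-hits rowTransversal i refl))))
    where
    hd-∈V : ∀ {e} → _∈V_ G (src e) (S i) × _∈V_ G (tgt e) (S i) → _∈V_ G (hd e) (S i)
    hd-∈V {e} (src∈ , tgt∈) with dir e
    ... | true  = tgt∈
    ... | false = src∈

  toVR : Fin b → VR n δ
  toVR i = reticulationOf i , reticulation⇒δ≡2 (reticulationOf-isReticulation i)

  toVR-injective : Injective _≡_ _≡_ toVR
  toVR-injective {i} {j} eq = reticulationOf-injective {i} {j} (cong proj₁ eq)

  VR-≡ : ∀ {x y : VR n δ} → proj₁ x ≡ proj₁ y → x ≡ y
  VR-≡ {r , p} {.r , q} refl = cong (r ,_) (ℕ.≡-irrelevant p q)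

  toVR-surjective : Surjective _≡_ _≡_ toVR
  toVR-surjective (r , δr≡2) =
    let i , i↦r = reticulationOf-onto r (δ≡2⇒reticulation δr≡2)
    in i , λ { {z} refl → VR-≡ {toVR z} {r , δr≡2} i↦r }

  matching : Fin b ⤖ VR n δ
  matching = mk⤖ {to = toVR} (toVR-injective , toVR-surjective)

theorem4 : (G : Graph) (k : ℕ) (lab : Fin k → Fin (Graph.n G)) →
    2 ≤ k → IsUndirBinPhyloNet G k lab →
    (eρ : Fin (Graph.m G)) (δ : Fin (Graph.n G) → ℕ) →
    (∃ λ (dir : Fin (Graph.m G) → Bool) → SatisfiesConstraint G eρ δ dir) →
    (b : ℕ) (S : Fin b → Cycle G) → IsCycleBasis G b S →
    ∃ λ (φ : Fin b ⤖ VR (Graph.n G) δ) →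
      ∀ C → _∈V_ G (proj₁ (Bijection.to φ C)) (S C)
theorem4 G k lab _ phylo eρ δ (dir , sat) b S basis = matching , reticulationOf-∈V
  where open CycleBasisMatching G (proj₁ phylo) eρ δ dir sat S basis
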